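{- Let $w\ge1$ and $k\ge1$ be integers and $\omega$ a weight. Let $W^{(k)}_n$ denote the weighted number of lattice paths from $(0,0)$ to $(n,0)$ with steps $(1,1)$, $(1,-1)$, $(w,0)$ that stay in the strip $0\le y\le k-1$, each horizontal step contributing a factor $\omega$. Then \[ \sum_{n\ge0}W^{(k)}_n t^n=\frac{p_{k-1}(t)}{t\,p_k(t)}, \] where $p_n(t)=\sum_{i=0}^{\lfloor n/2\rfloor}\binom{n-i}{i}(-1)^i\left(\frac{1-\omega t^w}{t}\right)^{n-2i}$. -}

module Defs where

open import Level using (Level)
open import Data.Bool.Base using (Bool; true; false; if_then_else_; _∧_)
open import Data.Nat.Base using (ℕ; zero; suc; _∸_; _≡ᵇ_; _<ᵇ_; _≤ᵇ_; ⌊_/2⌋)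
  renaming (_+_ to _+ℕ_; _*_ to _*ℕ_)
open import Data.Nat.Combinatorics using (_C_)
open import Algebra.Bundles using (CommutativeRing)

module Series {c ℓ : Level} (R : CommutativeRing c ℓ) where
  open CommutativeRing R

  fromℕ : ℕ → Carrier
  fromℕ zero = 0#
  fromℕ (suc n) = 1# + fromℕ n

  sign : ℕ → Carrier
  sign zero = 1#
  sign (suc i) = - sign i

  Ser : Set c
  Ser = ℕ → Carrier

  tPow : ℕ → Ser
  tPow m n = if m ≡ᵇ n then 1# else 0#

  one : Ser
  one = tPow 0

  _⊕_ : Ser → Ser → Ser
  (f ⊕ g) n = f n + g n

  _·_ : Carrier → Ser → Ser
  (a · f) n = a * f n

  neg : Ser → Ser
  neg f n = - f n

  convSum : ℕ → Ser → Ser → ℕ → Carrier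
  convSum zero f g m = f 0 * g m
  convSum (suc j) f g m = convSum j f g m + f (suc j) * g (m ∸ suc j)

  _⊛_ : Ser → Ser → Ser
  (f ⊛ g) n = convSum n f g n

  _^ˢ_ : Ser → ℕ → Ser
  f ^ˢ zero = one
  f ^ˢ suc n = f ⊛ (f ^ˢ n)

  sumSer : ℕ → (ℕ → Ser) → Ser
  sumSer zero F = F 0
  sumSer (suc m) F = sumSer m F ⊕ F (suc m)

  -- P w ω n = t^n p_n(t)
  --        = Σ_{i=0}^{⌊n/2⌋} C(n-i,i) (-1)^i (1 - ω t^w)^{n-2i} t^{2i}
  P : ℕ → Carrier → ℕ → Ser
  P w ω n = sumSer ⌊ n /2⌋ λ i →
    (fromℕ ((n ∸ i) C i) * sign i) ·
      (((one ⊕ neg (ω · tPow w)) ^ˢ (n ∸ (i +ℕ i))) ⊛ tPow (i +ℕ i))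

  -- go f n h : weighted number of paths of horizontal length n, starting at
  -- height h and ending at height 0, with steps (1,1),(1,-1),(w,0), staying
  -- in 0 ≤ y ≤ k-1; each (w,0) step weighs ω.  f is fuel (f ≥ n suffices,
  -- since every step has horizontal length ≥ 1 when w ≥ 1).
  -- contribution of a down step from height h (none if h = 0)
  downStep : (ℕ → Carrier) → ℕ → Carrier
  downStep g zero = 0#
  downStep g (suc h) = g h

  go : (k w : ℕ) → Carrier → ℕ → ℕ → ℕ → Carrier
  go k w ω zero n h = if (n ≡ᵇ 0) ∧ (h ≡ᵇ 0) then 1# else 0#
  go k w ω (suc f) zero h = if h ≡ᵇ 0 then 1# else 0#
  go k w ω (suc f) (suc n) h = (upS + downS) + flatS
    where
    upS = if suc h <ᵇ k then go k w ω f n (suc h) else 0#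
    downS = downStep (go k w ω f n) h
    flatS = if w ≤ᵇ suc n then ω * go k w ω f (suc n ∸ w) h else 0#

  W : (k w : ℕ) → Carrier → Ser
  W k w ω n = go k w ω n n 0

module Submission where

-- Write A = 1 - ω t^w and P_n = t^n p_n(t) (the series P of Defs); the claim
-- is P_k · W = P_{k-1}.  Let W_h count strip paths from height h down to 0.
-- Splitting off the first step gives, for 0 ≤ h < k,
--     W_h = [h = 0] + t (W_{h+1} + W_{h-1}) + ω t^w W_h
-- (neighbours outside the strip read as 0).  Since w ≥ 1, coefficient n of
-- the right-hand side only involves coefficients below n, so the source
-- determines the solution; multiplying by P_k, the family P_k W_h solves the
-- system with source [h = 0] P_k.  The Chebyshev-type recurrence
-- A P_{m+1} = P_{m+2} + t² P_m (from Pascal's rule) shows that Y_h =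
-- t^h P_{k-1-h} solves the same system, hence P_k W_0 = Y_0 = P_{k-1}.

open import Defs
open import Level using (Level)
open import Algebra.Bundles using (CommutativeRing)
open import Data.Nat.Base
  using ( ℕ; zero; suc; _∸_; _≤_; _<_; _≤′_; ≤′-reflexive; ≤′-step; z≤n; s≤s
        ; ⌊_/2⌋; _≡ᵇ_; _<ᵇ_; _≤ᵇ_ )
  renaming (_+_ to _+ℕ_)
open import Data.Nat.Properties
  using ( ≤-refl; ≤-trans; ≤-pred; <⇒≤; m≤n⇒m≤1+n; ≤′⇒≤; ≤⇒≤′; ≰⇒>; ≮⇒≥; _≤?_
        ; <⇒<ᵇ; <ᵇ⇒<; ⌊n/2⌋≤n; n∸n≡0; m∸n≤m; +-suc; +-∸-assoc; m≤n⇒m∸n≡0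
        ; m≤n+o⇒m∸n≤o; m<n+o⇒m∸n<o )
  renaming (+-comm to +ℕ-comm)
open import Data.Nat.Combinatorics using (_C_; k>n⇒nCk≡0; nCk+nC[k+1]≡[n+1]C[k+1])
open import Data.Nat.Induction using (<-rec)
open import Data.Bool.Base using (true; false; if_then_else_; T)
open import Data.Bool.Properties using (if-float)
open import Relation.Nullary using (yes; no)
open import Relation.Binary.Structures using (IsEquivalence)
open import Relation.Binary.Bundles using (Setoid)
open import Relation.Binary.PropositionalEquality as ≡ using (_≡_)
import Relation.Binary.Reasoning.Setoid as SetoidReasoning
import Algebra.Properties.CommutativeSemigroup as CommutativeSemigroupProperties

pascal-diagonal : ∀ m j → (suc m ∸ j) C suc j ≡ (m ∸ j) C j +ℕ (m ∸ j) C suc j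
pascal-diagonal m j with j ≤? m
... | yes j≤m = ≡.trans (≡.cong (_C suc j) (+-∸-assoc 1 j≤m))
                        (≡.sym (nCk+nC[k+1]≡[n+1]C[k+1] (m ∸ j) j))
... | no j≰m = beyond j (≰⇒> j≰m)
  where
  -- for j > m all three coefficients are C(0, ≥1) = 0
  beyond : ∀ j → m < j → (suc m ∸ j) C suc j ≡ (m ∸ j) C j +ℕ (m ∸ j) C suc j
  beyond (suc j) (s≤s m≤j) rewrite m≤n⇒m∸n≡0 m≤j | m≤n⇒m∸n≡0 (m≤n⇒m≤1+n m≤j) = ≡.refl

double-beyond-half : ∀ n i → ⌊ n /2⌋ < i → n < i +ℕ i
double-beyond-half zero (suc i) _ = s≤s z≤n
double-beyond-half (suc zero) (suc i) _ = s≤s (≡.subst (1 ≤_) (≡.sym (+-suc i i)) (s≤s z≤n))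
double-beyond-half (suc (suc n)) (suc i) (s≤s h) =
  ≡.subst (suc (suc n) <_) (≡.sym (≡.cong suc (+-suc i i))) (s≤s (s≤s (double-beyond-half n i h)))

binomial-beyond-half : ∀ n i → ⌊ n /2⌋ < i → (n ∸ i) C i ≡ 0
binomial-beyond-half n (suc i) h = k>n⇒nCk≡0 (m<n+o⇒m∸n<o n (suc i) (double-beyond-half n (suc i) h))

∸-split : ∀ {h k} → h < k → k ∸ h ≡ suc (k ∸ suc h)
∸-split {h} {suc k} (s≤s h≤k) = +-∸-assoc 1 h≤k

-- Formal power series over a commutative ring

module PowerSeries {c ℓ : Level} (R : CommutativeRing c ℓ) where
  open CommutativeRing R
  open Series R
  module ≈-Reasoning = SetoidReasoning setoid
  open CommutativeSemigroupProperties +-commutativeSemigroup using (interchange)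

  sumTo : ℕ → (ℕ → Carrier) → Carrier
  sumTo zero F = F 0
  sumTo (suc j) F = sumTo j F + F (suc j)

  sumTo-cong : ∀ j {F G} → (∀ i → i ≤ j → F i ≈ G i) → sumTo j F ≈ sumTo j G
  sumTo-cong zero F≈G = F≈G 0 z≤n
  sumTo-cong (suc j) F≈G =
    +-cong (sumTo-cong j (λ i i≤j → F≈G i (m≤n⇒m≤1+n i≤j))) (F≈G (suc j) ≤-refl)

  sumTo-+ : ∀ j F G → sumTo j (λ i → F i + G i) ≈ sumTo j F + sumTo j G
  sumTo-+ zero F G = refl
  sumTo-+ (suc j) F G = trans (+-congʳ (sumTo-+ j F G)) (interchange _ _ _ _)

  sumTo-*ˡ : ∀ j a F → a * sumTo j F ≈ sumTo j (λ i → a * F i)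
  sumTo-*ˡ zero a F = refl
  sumTo-*ˡ (suc j) a F = trans (distribˡ a _ _) (+-congʳ (sumTo-*ˡ j a F))

  sumTo-peel : ∀ j F → sumTo (suc j) F ≈ F 0 + sumTo j (λ i → F (suc i))
  sumTo-peel zero F = refl
  sumTo-peel (suc j) F = trans (+-congʳ (sumTo-peel j F)) (+-assoc _ _ _)

  sumTo-zero : ∀ j F → (∀ i → i ≤ j → F i ≈ 0#) → sumTo j F ≈ 0#
  sumTo-zero zero F F≈0 = F≈0 0 z≤n
  sumTo-zero (suc j) F F≈0 =
    trans (+-cong (sumTo-zero j F (λ i i≤j → F≈0 i (m≤n⇒m≤1+n i≤j))) (F≈0 (suc j) ≤-refl))
          (+-identityˡ 0#)

  sumTo-extend : ∀ {j j′} F → j ≤′ j′ → (∀ i → j < i → F i ≈ 0#) → sumTo j′ F ≈ sumTo j F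
  sumTo-extend F (≤′-reflexive ≡.refl) _ = refl
  sumTo-extend F (≤′-step j≤j′) F≈0 =
    trans (+-cong (sumTo-extend F j≤j′ F≈0) (F≈0 _ (s≤s (≤′⇒≤ j≤j′)))) (+-identityʳ _)

  infix 4 _≋_
  _≋_ : Ser → Ser → Set ℓ
  f ≋ g = ∀ n → f n ≈ g n

  ≋-isEquivalence : IsEquivalence _≋_
  ≋-isEquivalence = record
    { refl = λ n → refl ; sym = λ f≋g n → sym (f≋g n) ; trans = λ f≋g g≋h n → trans (f≋g n) (g≋h n) }

  ≋-setoid : Setoid c ℓ
  ≋-setoid = record { isEquivalence = ≋-isEquivalence }

  open IsEquivalence ≋-isEquivalence public
    using () renaming (refl to ≋-refl; sym to ≋-sym; trans to ≋-trans)

  module ≋-Reasoning = SetoidReasoning ≋-setoid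

  ≡⇒≋ : ∀ {f g} → f ≡ g → f ≋ g
  ≡⇒≋ ≡.refl = ≋-refl

  zeroS : Ser
  zeroS _ = 0#

  ⊕-cong : ∀ {f f′ g g′} → f ≋ f′ → g ≋ g′ → (f ⊕ g) ≋ (f′ ⊕ g′)
  ⊕-cong f≋f′ g≋g′ n = +-cong (f≋f′ n) (g≋g′ n)

  ⊕-assoc : ∀ f g h → ((f ⊕ g) ⊕ h) ≋ (f ⊕ (g ⊕ h))
  ⊕-assoc f g h n = +-assoc _ _ _

  ⊕-comm : ∀ f g → (f ⊕ g) ≋ (g ⊕ f)
  ⊕-comm f g n = +-comm _ _

  ⊕-identityˡ : ∀ f → (zeroS ⊕ f) ≋ f
  ⊕-identityˡ f n = +-identityˡ _

  ⊕-identityʳ : ∀ f → (f ⊕ zeroS) ≋ f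
  ⊕-identityʳ f n = +-identityʳ _

  ·-cong : ∀ {a b f g} → a ≈ b → f ≋ g → (a · f) ≋ (b · g)
  ·-cong a≈b f≋g n = *-cong a≈b (f≋g n)

  ·-distribʳ : ∀ a b f → ((a + b) · f) ≋ ((a · f) ⊕ (b · f))
  ·-distribʳ a b f n = distribʳ (f n) a b

  ·-zero : ∀ {a} f → a ≈ 0# → (a · f) ≋ zeroS
  ·-zero f a≈0 n = trans (*-congʳ a≈0) (zeroˡ _)

  shift : ℕ → Ser → Ser
  shift zero f n = f n
  shift (suc s) f zero = 0#
  shift (suc s) f (suc n) = shift s f n

  shift-coeff : ∀ s f n → shift s f n ≡ (if s <ᵇ suc n then f (n ∸ s) else 0#)
  shift-coeff zero f n = ≡.refl
  shift-coeff (suc s) f zero = ≡.refl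
  shift-coeff (suc s) f (suc n) = shift-coeff s f n

  shift-cong : ∀ s {f g} → f ≋ g → shift s f ≋ shift s g
  shift-cong zero f≋g n = f≋g n
  shift-cong (suc s) f≋g zero = refl
  shift-cong (suc s) f≋g (suc n) = shift-cong s f≋g n

  shift-ext : ∀ s {f g} n → (∀ j → j ≤ n → f j ≈ g j) → shift s f n ≈ shift s g n
  shift-ext zero n f≈g = f≈g n ≤-refl
  shift-ext (suc s) zero f≈g = refl
  shift-ext (suc s) (suc n) f≈g = shift-ext s n (λ j j≤n → f≈g j (m≤n⇒m≤1+n j≤n))

  shift-local : ∀ s {f g} n → (∀ j → j < n → f j ≈ g j) → shift (suc s) f n ≈ shift (suc s) g n
  shift-local s zero f≈g = refl
  shift-local s (suc n) f≈g = shift-ext s n (λ j j≤n → f≈g j (s≤s j≤n))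

  shift-⊕ : ∀ s f g → shift s (f ⊕ g) ≋ (shift s f ⊕ shift s g)
  shift-⊕ zero f g n = refl
  shift-⊕ (suc s) f g zero = sym (+-identityˡ 0#)
  shift-⊕ (suc s) f g (suc n) = shift-⊕ s f g n

  shift-· : ∀ s a f → shift s (a · f) ≋ (a · shift s f)
  shift-· zero a f n = refl
  shift-· (suc s) a f zero = sym (zeroʳ a)
  shift-· (suc s) a f (suc n) = shift-· s a f n

  shift-zero : ∀ s → shift s zeroS ≋ zeroS
  shift-zero zero n = refl
  shift-zero (suc s) zero = refl
  shift-zero (suc s) (suc n) = shift-zero s n

  shift-shift : ∀ a b f → shift a (shift b f) ≋ shift (a +ℕ b) f
  shift-shift zero b f n = refl
  shift-shift (suc a) b f zero = refl
  shift-shift (suc a) b f (suc n) = shift-shift a b f n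

  sumSer-sumTo : ∀ j F n → sumSer j F n ≡ sumTo j (λ i → F i n)
  sumSer-sumTo zero F n = ≡.refl
  sumSer-sumTo (suc j) F n = ≡.cong (_+ F (suc j) n) (sumSer-sumTo j F n)

  shift-sumSer : ∀ s j F → shift s (sumSer j F) ≋ sumSer j (λ i → shift s (F i))
  shift-sumSer s zero F = ≋-refl
  shift-sumSer s (suc j) F = ≋-trans (shift-⊕ s _ _) (⊕-cong (shift-sumSer s j F) ≋-refl)

  conv-sumTo : ∀ f g n → (f ⊛ g) n ≡ sumTo n (λ i → f i * g (n ∸ i))
  conv-sumTo f g n = partial n n
    where
    partial : ∀ j m → convSum j f g m ≡ sumTo j (λ i → f i * g (m ∸ i))
    partial zero m = ≡.refl
    partial (suc j) m = ≡.cong (_+ f (suc j) * g (m ∸ suc j)) (partial j m)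

  conv-termwise : ∀ f g (F : ℕ → ℕ → Carrier) →
    (∀ n i → i ≤ n → f i * g (n ∸ i) ≈ F n i) → ∀ n → (f ⊛ g) n ≈ sumTo n (F n)
  conv-termwise f g F eq n = trans (reflexive (conv-sumTo f g n)) (sumTo-cong n (eq n))

  conv-cong : ∀ {f f′ g g′} → f ≋ f′ → g ≋ g′ → (f ⊛ g) ≋ (f′ ⊛ g′)
  conv-cong {f} {f′} {g} {g′} f≋f′ g≋g′ n =
    trans (conv-termwise f g _ (λ n i _ → *-cong (f≋f′ i) (g≋g′ (n ∸ i))) n)
          (sym (reflexive (conv-sumTo f′ g′ n)))

  conv-⊕ʳ : ∀ f g h → (f ⊛ (g ⊕ h)) ≋ ((f ⊛ g) ⊕ (f ⊛ h))
  conv-⊕ʳ f g h n = begin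
    (f ⊛ (g ⊕ h)) n                                      ≈⟨ conv-termwise _ _ _ (λ _ _ _ → distribˡ _ _ _) n ⟩
    sumTo n (λ i → f i * g (n ∸ i) + f i * h (n ∸ i))   ≈⟨ sumTo-+ n _ _ ⟩
    sumTo n (λ i → f i * g (n ∸ i)) + sumTo n (λ i → f i * h (n ∸ i))
      ≡⟨ ≡.sym (≡.cong₂ _+_ (conv-sumTo f g n) (conv-sumTo f h n)) ⟩
    ((f ⊛ g) ⊕ (f ⊛ h)) n                                ∎
    where open ≈-Reasoning

  conv-⊕ˡ : ∀ f g h → ((g ⊕ h) ⊛ f) ≋ ((g ⊛ f) ⊕ (h ⊛ f))
  conv-⊕ˡ f g h n = begin
    ((g ⊕ h) ⊛ f) n                                      ≈⟨ conv-termwise _ _ _ (λ _ _ _ → distribʳ _ _ _) n ⟩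
    sumTo n (λ i → g i * f (n ∸ i) + h i * f (n ∸ i))   ≈⟨ sumTo-+ n _ _ ⟩
    sumTo n (λ i → g i * f (n ∸ i)) + sumTo n (λ i → h i * f (n ∸ i))
      ≡⟨ ≡.sym (≡.cong₂ _+_ (conv-sumTo g f n) (conv-sumTo h f n)) ⟩
    ((g ⊛ f) ⊕ (h ⊛ f)) n                                ∎
    where open ≈-Reasoning

  conv-·ʳ : ∀ f a g → (f ⊛ (a · g)) ≋ (a · (f ⊛ g))
  conv-·ʳ f a g n = begin
    (f ⊛ (a · g)) n                     ≈⟨ conv-termwise _ _ _ (λ _ _ _ → x∙yz≈y∙xz _ _ _) n ⟩
    sumTo n (λ i → a * (f i * g (n ∸ i)))  ≈⟨ sym (sumTo-*ˡ n a _) ⟩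
    a * sumTo n (λ i → f i * g (n ∸ i))    ≡⟨ ≡.cong (a *_) (≡.sym (conv-sumTo f g n)) ⟩
    (a · (f ⊛ g)) n                     ∎
    where
    open ≈-Reasoning
    open CommutativeSemigroupProperties *-commutativeSemigroup using (x∙yz≈y∙xz)

  conv-·ˡ : ∀ f a g → ((a · g) ⊛ f) ≋ (a · (g ⊛ f))
  conv-·ˡ f a g n = begin
    ((a · g) ⊛ f) n                        ≈⟨ conv-termwise _ _ _ (λ _ _ _ → *-assoc _ _ _) n ⟩
    sumTo n (λ i → a * (g i * f (n ∸ i)))  ≈⟨ sym (sumTo-*ˡ n a _) ⟩
    a * sumTo n (λ i → g i * f (n ∸ i))    ≡⟨ ≡.cong (a *_) (≡.sym (conv-sumTo g f n)) ⟩
    (a · (g ⊛ f)) n                        ∎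
    where open ≈-Reasoning

  conv-zeroʳ : ∀ f → (f ⊛ zeroS) ≋ zeroS
  conv-zeroʳ f n = trans (reflexive (conv-sumTo f zeroS n)) (sumTo-zero n _ (λ i _ → zeroʳ _))

  conv-shift1ˡ : ∀ f g → (shift 1 f ⊛ g) ≋ shift 1 (f ⊛ g)
  conv-shift1ˡ f g zero = zeroˡ _
  conv-shift1ˡ f g (suc n) = begin
    (shift 1 f ⊛ g) (suc n)                                ≡⟨ conv-sumTo (shift 1 f) g (suc n) ⟩
    sumTo (suc n) (λ i → shift 1 f i * g (suc n ∸ i))      ≈⟨ sumTo-peel n _ ⟩
    0# * g (suc n) + sumTo n (λ i → f i * g (n ∸ i))       ≈⟨ +-congʳ (zeroˡ _) ⟩
    0# + sumTo n (λ i → f i * g (n ∸ i))                   ≈⟨ +-identityˡ _ ⟩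
    sumTo n (λ i → f i * g (n ∸ i))                        ≡⟨ ≡.sym (conv-sumTo f g n) ⟩
    shift 1 (f ⊛ g) (suc n)                                ∎
    where open ≈-Reasoning

  conv-shift1ʳ : ∀ f g → (f ⊛ shift 1 g) ≋ shift 1 (f ⊛ g)
  conv-shift1ʳ f g zero = zeroʳ _
  conv-shift1ʳ f g (suc n) = begin
    (f ⊛ shift 1 g) (suc n)                                              ≡⟨ conv-sumTo f (shift 1 g) (suc n) ⟩
    sumTo n (λ i → f i * shift 1 g (suc n ∸ i)) + f (suc n) * shift 1 g (suc n ∸ suc n)
      ≈⟨ +-cong (sumTo-cong n (λ i i≤n → *-congˡ (reflexive (≡.cong (shift 1 g) (+-∸-assoc 1 i≤n)))))
                (*-congˡ (reflexive (≡.cong (shift 1 g) (n∸n≡0 n)))) ⟩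
    sumTo n (λ i → f i * g (n ∸ i)) + f (suc n) * 0#                     ≈⟨ +-congˡ (zeroʳ _) ⟩
    sumTo n (λ i → f i * g (n ∸ i)) + 0#                                 ≈⟨ +-identityʳ _ ⟩
    sumTo n (λ i → f i * g (n ∸ i))                                      ≡⟨ ≡.sym (conv-sumTo f g n) ⟩
    shift 1 (f ⊛ g) (suc n)                                              ∎
    where open ≈-Reasoning

  conv-shiftˡ : ∀ s f g → (shift s f ⊛ g) ≋ shift s (f ⊛ g)
  conv-shiftˡ zero f g n = refl
  conv-shiftˡ (suc s) f g = begin
    shift (suc s) f ⊛ g           ≈⟨ conv-cong (≋-sym (shift-shift 1 s f)) ≋-refl ⟩
    shift 1 (shift s f) ⊛ g       ≈⟨ conv-shift1ˡ (shift s f) g ⟩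
    shift 1 (shift s f ⊛ g)       ≈⟨ shift-cong 1 (conv-shiftˡ s f g) ⟩
    shift 1 (shift s (f ⊛ g))     ≈⟨ shift-shift 1 s (f ⊛ g) ⟩
    shift (suc s) (f ⊛ g)         ∎
    where open ≋-Reasoning

  conv-shiftʳ : ∀ s f g → (f ⊛ shift s g) ≋ shift s (f ⊛ g)
  conv-shiftʳ zero f g n = refl
  conv-shiftʳ (suc s) f g = begin
    f ⊛ shift (suc s) g           ≈⟨ conv-cong ≋-refl (≋-sym (shift-shift 1 s g)) ⟩
    f ⊛ shift 1 (shift s g)       ≈⟨ conv-shift1ʳ f (shift s g) ⟩
    shift 1 (f ⊛ shift s g)       ≈⟨ shift-cong 1 (conv-shiftʳ s f g) ⟩
    shift 1 (shift s (f ⊛ g))     ≈⟨ shift-shift 1 s (f ⊛ g) ⟩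
    shift (suc s) (f ⊛ g)         ∎
    where open ≋-Reasoning

  conv-oneˡ : ∀ g → (one ⊛ g) ≋ g
  conv-oneˡ g zero = *-identityˡ _
  conv-oneˡ g (suc n) = begin
    (one ⊛ g) (suc n)                                   ≡⟨ conv-sumTo one g (suc n) ⟩
    sumTo (suc n) (λ i → one i * g (suc n ∸ i))         ≈⟨ sumTo-peel n _ ⟩
    1# * g (suc n) + sumTo n (λ i → 0# * g (n ∸ i))
      ≈⟨ +-cong (*-identityˡ _) (sumTo-zero n _ (λ i _ → zeroˡ _)) ⟩
    g (suc n) + 0#                                      ≈⟨ +-identityʳ _ ⟩
    g (suc n)                                           ∎
    where open ≈-Reasoning

  conv-oneʳ : ∀ f → (f ⊛ one) ≋ f
  conv-oneʳ f zero = *-identityʳ _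
  conv-oneʳ f (suc n) = begin
    (f ⊛ one) (suc n)                                                  ≡⟨ conv-sumTo f one (suc n) ⟩
    sumTo n (λ i → f i * one (suc n ∸ i)) + f (suc n) * one (suc n ∸ suc n)
      ≈⟨ +-cong (sumTo-zero n _ (λ i i≤n →
                  trans (*-congˡ (reflexive (≡.cong one (+-∸-assoc 1 i≤n)))) (zeroʳ _)))
                (*-congˡ (reflexive (≡.cong one (n∸n≡0 n)))) ⟩
    0# + f (suc n) * 1#                                                ≈⟨ +-identityˡ _ ⟩
    f (suc n) * 1#                                                     ≈⟨ *-identityʳ _ ⟩
    f (suc n)                                                          ∎
    where open ≈-Reasoning

  tPow-shift : ∀ m → tPow m ≋ shift m one
  tPow-shift zero zero = refl
  tPow-shift zero (suc n) = refl
  tPow-shift (suc m) zero = refl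
  tPow-shift (suc m) (suc n) = tPow-shift m n

  conv-tPowˡ : ∀ m f → (tPow m ⊛ f) ≋ shift m f
  conv-tPowˡ m f = ≋-trans (conv-cong (tPow-shift m) ≋-refl)
                           (≋-trans (conv-shiftˡ m one f) (shift-cong m (conv-oneˡ f)))

  conv-tPowʳ : ∀ m f → (f ⊛ tPow m) ≋ shift m f
  conv-tPowʳ m f = ≋-trans (conv-cong ≋-refl (tPow-shift m))
                           (≋-trans (conv-shiftʳ m f one) (shift-cong m (conv-oneʳ f)))

  conv-sumSerʳ : ∀ f j F → (f ⊛ sumSer j F) ≋ sumSer j (λ i → f ⊛ F i)
  conv-sumSerʳ f zero F = ≋-refl
  conv-sumSerʳ f (suc j) F = ≋-trans (conv-⊕ʳ f _ _) (⊕-cong (conv-sumSerʳ f j F) ≋-refl)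

-- The recurrence of the series P_n = t^n p_n(t)

module StripPolynomials {c ℓ : Level} (R : CommutativeRing c ℓ)
                        (ω : CommutativeRing.Carrier R) (w : ℕ) where
  open CommutativeRing R
  open Series R
  open PowerSeries R

  A : Ser
  A = one ⊕ neg (ω · tPow w)

  A-complement : (A ⊕ (ω · tPow w)) ≋ one
  A-complement n =
    trans (+-assoc _ _ _) (trans (+-congˡ (-‿inverseˡ _)) (+-identityʳ _))

  A-split : ∀ X → X ≋ ((A ⊛ X) ⊕ (ω · shift w X))
  A-split X = begin
    X                                     ≈⟨ ≋-sym (conv-oneˡ X) ⟩
    one ⊛ X                               ≈⟨ conv-cong (≋-sym A-complement) ≋-refl ⟩
    (A ⊕ (ω · tPow w)) ⊛ X                ≈⟨ conv-⊕ˡ X A _ ⟩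
    (A ⊛ X) ⊕ ((ω · tPow w) ⊛ X)          ≈⟨ ⊕-cong ≋-refl (conv-·ˡ X ω (tPow w)) ⟩
    (A ⊛ X) ⊕ (ω · (tPow w ⊛ X))          ≈⟨ ⊕-cong ≋-refl (·-cong refl (conv-tPowˡ w X)) ⟩
    (A ⊛ X) ⊕ (ω · shift w X)             ∎
    where open ≋-Reasoning

  fromℕ-+ : ∀ a b → fromℕ (a +ℕ b) ≈ fromℕ a + fromℕ b
  fromℕ-+ zero b = sym (+-identityˡ _)
  fromℕ-+ (suc a) b = trans (+-congˡ (fromℕ-+ a b)) (sym (+-assoc _ _ _))

  coef : ℕ → ℕ → Carrier
  coef n i = fromℕ ((n ∸ i) C i) * sign i

  term : ℕ → ℕ → Ser
  term n i = coef n i · ((A ^ˢ (n ∸ (i +ℕ i))) ⊛ tPow (i +ℕ i))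

  -- Multiplication by t^{2i} is a shift; for i = j + 1 we normalise 2i to 2 + 2j.
  term-shift : ∀ n i → term n i ≋ coef n i · shift (i +ℕ i) (A ^ˢ (n ∸ (i +ℕ i)))
  term-shift n i = ·-cong refl (conv-tPowʳ (i +ℕ i) _)

  term-shift-suc : ∀ n j →
    term n (suc j) ≋ coef n (suc j) · shift (2 +ℕ (j +ℕ j)) (A ^ˢ (n ∸ (2 +ℕ (j +ℕ j))))
  term-shift-suc n j = ≋-trans (term-shift n (suc j))
    (≡⇒≋ (≡.cong (λ d → coef n (suc j) · shift d (A ^ˢ (n ∸ d))) (≡.cong suc (+-suc j j))))

  term-first : ∀ n → term n 0 ≋ A ^ˢ n
  term-first n x =
    trans (term-shift n 0 x) (trans (*-congʳ (trans (*-identityʳ _) (+-identityʳ _))) (*-identityˡ _))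

  coef-vanish : ∀ n i → (n ∸ i) C i ≡ 0 → coef n i ≈ 0#
  coef-vanish n i C≡0 = trans (*-congʳ (reflexive (≡.cong fromℕ C≡0))) (zeroˡ _)

  P-sum : ∀ n N → ⌊ n /2⌋ ≤ N → P w ω n ≋ sumSer N (term n)
  P-sum n N half≤N x = begin
    P w ω n x                           ≡⟨ sumSer-sumTo ⌊ n /2⌋ (term n) x ⟩
    sumTo ⌊ n /2⌋ (λ i → term n i x)    ≈⟨ sym (sumTo-extend _ (≤⇒≤′ half≤N) beyond) ⟩
    sumTo N (λ i → term n i x)          ≡⟨ ≡.sym (sumSer-sumTo N (term n) x) ⟩
    sumSer N (term n) x                 ∎
    where
    open ≈-Reasoning
    beyond : ∀ i → ⌊ n /2⌋ < i → term n i x ≈ 0#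
    beyond i half<i = ·-zero ((A ^ˢ (n ∸ (i +ℕ i))) ⊛ tPow (i +ℕ i))
                             (coef-vanish n i (binomial-beyond-half n i half<i)) x

  coef-pascal : ∀ m j → coef (suc m) (suc j) ≈ coef (suc (suc m)) (suc j) + coef m j
  coef-pascal m j = sym (begin
    fromℕ ((suc m ∸ j) C suc j) * - s + fromℕ x * s
      ≡⟨ ≡.cong (λ z → fromℕ z * - s + fromℕ x * s) (pascal-diagonal m j) ⟩
    fromℕ (x +ℕ y) * - s + fromℕ x * s        ≈⟨ +-congʳ (trans (*-congʳ (fromℕ-+ x y)) (distribʳ _ _ _)) ⟩
    (fromℕ x * - s + fromℕ y * - s) + fromℕ x * s
      ≈⟨ trans (+-congʳ (+-comm _ _)) (+-assoc _ _ _) ⟩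
    fromℕ y * - s + (fromℕ x * - s + fromℕ x * s)
      ≈⟨ +-congˡ (trans (sym (distribˡ _ _ _)) (trans (*-congˡ (-‿inverseˡ s)) (zeroʳ _))) ⟩
    fromℕ y * - s + 0#                         ≈⟨ +-identityʳ _ ⟩
    fromℕ y * - s                              ∎)
    where
    open ≈-Reasoning
    s : Carrier
    s = sign j
    x y : ℕ
    x = (m ∸ j) C j
    y = (m ∸ j) C suc j

  -- Multiplying the (j+1)-st summand of P_{m+1} by A raises its power of A
  -- (if that power would exceed the range, the coefficient is already 0).
  A-term : ∀ m j → (A ⊛ term (suc m) (suc j)) ≋
                coef (suc m) (suc j) · shift (2 +ℕ (j +ℕ j)) (A ^ˢ (m ∸ (j +ℕ j)))
  A-term m j with suc (j +ℕ j) ≤? m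
  ... | yes 2j<m = begin
    A ⊛ term (suc m) (suc j)                ≈⟨ conv-cong ≋-refl (term-shift-suc (suc m) j) ⟩
    A ⊛ (a · shift d (A ^ˢ (suc m ∸ d)))    ≈⟨ conv-·ʳ A a _ ⟩
    a · (A ⊛ shift d (A ^ˢ (suc m ∸ d)))    ≈⟨ ·-cong refl (conv-shiftʳ d A _) ⟩
    a · shift d (A ^ˢ suc (suc m ∸ d))
      ≡⟨ ≡.cong (λ e → a · shift d (A ^ˢ e)) (≡.sym (+-∸-assoc 1 2j<m)) ⟩
    a · shift d (A ^ˢ (m ∸ (j +ℕ j)))       ∎
    where
    open ≋-Reasoning
    a : Carrier
    a = coef (suc m) (suc j)
    d : ℕ
    d = 2 +ℕ (j +ℕ j)
  ... | no 2j≮m = ≋-trans (conv-cong ≋-refl (·-zero _ a≈0)) (≋-trans (conv-zeroʳ A) (≋-sym (·-zero _ a≈0)))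
    where
    a≈0 : coef (suc m) (suc j) ≈ 0#
    a≈0 = coef-vanish (suc m) (suc j) (k>n⇒nCk≡0 (s≤s (m≤n+o⇒m∸n≤o m j (≤-pred (≰⇒> 2j≮m)))))

  -- Termwise recurrence: A term_{m+1,j+1} = term_{m+2,j+1} + t² term_{m,j}.
  -- With S E = t^{2j+2} A^{m-2j} all three are multiples of S E, and the
  -- multipliers are related by Pascal's rule.
  term-pascal : ∀ m j → (A ⊛ term (suc m) (suc j)) ≋ (term (suc (suc m)) (suc j) ⊕ shift 2 (term m j))
  term-pascal m j = begin
    A ⊛ term (suc m) (suc j)                          ≈⟨ A-term m j ⟩
    coef (suc m) (suc j) · S E                        ≈⟨ ·-cong (coef-pascal m j) ≋-refl ⟩
    (coef (suc (suc m)) (suc j) + coef m j) · S E     ≈⟨ ·-distribʳ _ _ _ ⟩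
    (coef (suc (suc m)) (suc j) · S E) ⊕ (coef m j · S E)
      ≈⟨ ⊕-cong (≋-sym (term-shift-suc (suc (suc m)) j)) (≋-sym lowered) ⟩
    term (suc (suc m)) (suc j) ⊕ shift 2 (term m j)   ∎
    where
    open ≋-Reasoning
    S : Ser → Ser
    S = shift (2 +ℕ (j +ℕ j))
    E : Ser
    E = A ^ˢ (m ∸ (j +ℕ j))
    lowered : shift 2 (term m j) ≋ coef m j · S E
    lowered = ≋-trans (shift-cong 2 (term-shift m j))
                (≋-trans (shift-· 2 (coef m j) _) (·-cong refl (shift-shift 2 (j +ℕ j) E)))

  -- The Chebyshev-type recurrence A P_{m+1} = P_{m+2} + t² P_m: sum the
  -- termwise recurrence over j, the j = 0 terms being A^{m+1} and A^{m+2}.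
  P-recurrence : ∀ m → (A ⊛ P w ω (suc m)) ≋ (P w ω (suc (suc m)) ⊕ shift 2 (P w ω m))
  P-recurrence m x = begin
    (A ⊛ P w ω (suc m)) x                                        ≈⟨ multiplied ⟩
    sumTo (suc (suc m)) (λ i → (A ⊛ term (suc m) i) x)           ≈⟨ sumTo-peel (suc m) _ ⟩
    (A ⊛ term (suc m) 0) x + sumTo (suc m) (λ j → (A ⊛ term (suc m) (suc j)) x)
      ≈⟨ +-cong (first x) (sumTo-cong (suc m) (λ j _ → term-pascal m j x)) ⟩
    term (suc (suc m)) 0 x + sumTo (suc m) (λ j → term (suc (suc m)) (suc j) x + shift 2 (term m j) x)
      ≈⟨ trans (+-congˡ (sumTo-+ (suc m) _ _)) (sym (+-assoc _ _ _)) ⟩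
    (term (suc (suc m)) 0 x + sumTo (suc m) (λ j → term (suc (suc m)) (suc j) x))
      + sumTo (suc m) (λ j → shift 2 (term m j) x)
      ≈⟨ +-cong (sym (trans upper (sumTo-peel (suc m) _))) (sym lower) ⟩
    P w ω (suc (suc m)) x + shift 2 (P w ω m) x                  ∎
    where
    open ≈-Reasoning
    half≤ : ∀ n → ⌊ n /2⌋ ≤ suc n
    half≤ n = m≤n⇒m≤1+n (⌊n/2⌋≤n n)
    multiplied : (A ⊛ P w ω (suc m)) x ≈ sumTo (suc (suc m)) (λ i → (A ⊛ term (suc m) i) x)
    multiplied = trans (conv-cong ≋-refl (P-sum (suc m) (suc (suc m)) (half≤ (suc m))) x)
                 (trans (conv-sumSerʳ A (suc (suc m)) _ x) (reflexive (sumSer-sumTo (suc (suc m)) _ x)))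
    upper : P w ω (suc (suc m)) x ≈ sumTo (suc (suc m)) (λ i → term (suc (suc m)) i x)
    upper = trans (P-sum (suc (suc m)) (suc (suc m)) (⌊n/2⌋≤n (suc (suc m))) x)
                  (reflexive (sumSer-sumTo (suc (suc m)) (term (suc (suc m))) x))
    lower : shift 2 (P w ω m) x ≈ sumTo (suc m) (λ j → shift 2 (term m j) x)
    lower = trans (shift-cong 2 (P-sum m (suc m) (half≤ m)) x)
                  (trans (shift-sumSer 2 (suc m) _ x) (reflexive (sumSer-sumTo (suc m) _ x)))
    first : (A ⊛ term (suc m) 0) ≋ term (suc (suc m)) 0
    first = ≋-trans (conv-cong ≋-refl (term-first (suc m))) (≋-sym (term-first (suc (suc m))))

  -- Q_{n+1} = P_n and Q_0 = 0; with this convention the recurrence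
  -- A Q_{n+1} = Q_{n+2} + t² Q_n holds from n = 0 on.
  Q : ℕ → Ser
  Q zero = zeroS
  Q (suc n) = P w ω n

  Q-recurrence : ∀ n → (A ⊛ Q (suc n)) ≋ (Q (suc (suc n)) ⊕ shift 2 (Q n))
  Q-recurrence zero = begin
    A ⊛ P w ω 0                    ≈⟨ conv-cong ≋-refl (term-first 0) ⟩
    A ⊛ one                        ≈⟨ conv-oneʳ A ⟩
    A                              ≈⟨ ≋-sym (≋-trans (term-first 1) (conv-oneʳ A)) ⟩
    P w ω 1                        ≈⟨ ≋-sym (⊕-identityʳ _) ⟩
    P w ω 1 ⊕ zeroS                ≈⟨ ⊕-cong ≋-refl (≋-sym (shift-zero 2)) ⟩
    P w ω 1 ⊕ shift 2 zeroS        ∎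
    where open ≋-Reasoning
  Q-recurrence (suc m) = P-recurrence m

-- The first-step system of the strip 0 ≤ y < k, for horizontal steps of
-- length w = w′ + 1 ≥ 1

module Strip {c ℓ : Level} (R : CommutativeRing c ℓ) (w′ k : ℕ) (ω : CommutativeRing.Carrier R) where
  open CommutativeRing R
  open Series R
  open PowerSeries R
  open StripPolynomials R ω (suc w′)

  w : ℕ
  w = suc w′

  up : (ℕ → Ser) → ℕ → Ser
  up Z h = if suc h <ᵇ k then Z (suc h) else zeroS

  down : (ℕ → Ser) → ℕ → Ser
  down Z zero = zeroS
  down Z (suc h) = Z h

  Solves : (ℕ → Ser) → (ℕ → Ser) → Set ℓ
  Solves D Z = ∀ h → h < k → Z h ≋ (D h ⊕ (shift 1 (up Z h ⊕ down Z h) ⊕ (ω · shift w (Z h))))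

  up-local : ∀ {Z Z′} j → (∀ h → h < k → Z h j ≈ Z′ h j) → ∀ h → up Z h j ≈ up Z′ h j
  up-local j agree h with suc h <ᵇ k in eq
  ... | true = agree (suc h) (<ᵇ⇒< (suc h) k (≡.subst T (≡.sym eq) _))
  ... | false = refl

  down-local : ∀ {Z Z′} j → (∀ h → h < k → Z h j ≈ Z′ h j) → ∀ h → h < k → down Z h j ≈ down Z′ h j
  down-local j agree zero _ = refl
  down-local j agree (suc h) h<k = agree h (<⇒≤ h<k)

  -- Since w ≥ 1, coefficient n of the right-hand side only involves the
  -- coefficients of Z below n; by strong induction on n, the source
  -- determines the solution.
  solution-unique : ∀ {D Z Z′} → Solves D Z → Solves D Z′ → ∀ n h → h < k → Z h n ≈ Z′ h n
  solution-unique {D} {Z} {Z′} sol sol′ = <-rec _ step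
    where
    step : ∀ n → (∀ {j} → j < n → ∀ h → h < k → Z h j ≈ Z′ h j) → ∀ h → h < k → Z h n ≈ Z′ h n
    step n below h h<k = begin
      Z h n                                                              ≈⟨ sol h h<k n ⟩
      (D h ⊕ (shift 1 (up Z h ⊕ down Z h) ⊕ (ω · shift w (Z h)))) n
        ≈⟨ +-congˡ (+-cong (shift-local 0 n neighbours) (*-congˡ (shift-local w′ n self))) ⟩
      (D h ⊕ (shift 1 (up Z′ h ⊕ down Z′ h) ⊕ (ω · shift w (Z′ h)))) n  ≈⟨ sym (sol′ h h<k n) ⟩
      Z′ h n                                                             ∎
      where
      open ≈-Reasoning
      neighbours : ∀ j → j < n → up Z h j + down Z h j ≈ up Z′ h j + down Z′ h j
      neighbours j j<n =
        +-cong (up-local {Z} {Z′} j (below j<n) h) (down-local {Z} {Z′} j (below j<n) h h<k)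
      self : ∀ j → j < n → Z h j ≈ Z′ h j
      self j j<n = below j<n h h<k

  up-⊛ : ∀ F Z h → (F ⊛ up Z h) ≋ up (λ h′ → F ⊛ Z h′) h
  up-⊛ F Z h with suc h <ᵇ k
  ... | true = ≋-refl
  ... | false = conv-zeroʳ F

  down-⊛ : ∀ F Z h → (F ⊛ down Z h) ≋ down (λ h′ → F ⊛ Z h′) h
  down-⊛ F Z zero = conv-zeroʳ F
  down-⊛ F Z (suc h) = ≋-refl

  Solves-⊛ : ∀ F {D Z} → Solves D Z → Solves (λ h → F ⊛ D h) (λ h → F ⊛ Z h)
  Solves-⊛ F {D} {Z} sol h h<k = begin
    F ⊛ Z h                                                                   ≈⟨ conv-cong ≋-refl (sol h h<k) ⟩
    F ⊛ (D h ⊕ (shift 1 (up Z h ⊕ down Z h) ⊕ (ω · shift w (Z h))))           ≈⟨ conv-⊕ʳ F _ _ ⟩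
    (F ⊛ D h) ⊕ (F ⊛ (shift 1 (up Z h ⊕ down Z h) ⊕ (ω · shift w (Z h))))
      ≈⟨ ⊕-cong ≋-refl (conv-⊕ʳ F _ _) ⟩
    (F ⊛ D h) ⊕ ((F ⊛ shift 1 (up Z h ⊕ down Z h)) ⊕ (F ⊛ (ω · shift w (Z h))))
      ≈⟨ ⊕-cong ≋-refl (⊕-cong neighbours horizontal) ⟩
    (F ⊛ D h) ⊕ (shift 1 (up FZ h ⊕ down FZ h) ⊕ (ω · shift w (FZ h)))        ∎
    where
    open ≋-Reasoning
    FZ : ℕ → Ser
    FZ h′ = F ⊛ Z h′
    neighbours : (F ⊛ shift 1 (up Z h ⊕ down Z h)) ≋ shift 1 (up FZ h ⊕ down FZ h)
    neighbours = ≋-trans (conv-shiftʳ 1 F _)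
      (shift-cong 1 (≋-trans (conv-⊕ʳ F _ _) (⊕-cong (up-⊛ F Z h) (down-⊛ F Z h))))
    horizontal : (F ⊛ (ω · shift w (Z h))) ≋ (ω · shift w (FZ h))
    horizontal = ≋-trans (conv-·ʳ F ω _) (·-cong refl (conv-shiftʳ w F (Z h)))

  walks : ℕ → Ser
  walks h n = go k w ω n n h

  go-empty : ∀ f h → go k w ω f 0 h ≡ (if h ≡ᵇ 0 then 1# else 0#)
  go-empty zero h = ≡.refl
  go-empty (suc f) h = ≡.refl

  -- The fuel of go is irrelevant once it covers the length (each step has length ≥ 1).
  go-fuel : ∀ f f′ n h → n ≤ f → n ≤ f′ → go k w ω f n h ≡ go k w ω f′ n h
  go-fuel f f′ zero h _ _ = ≡.trans (go-empty f h) (≡.sym (go-empty f′ h))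
  go-fuel (suc f) (suc f′) (suc n) h (s≤s n≤f) (s≤s n≤f′) =
    ≡.cong₂ _+_ (≡.cong₂ _+_ upwards (downwards h)) horizontal
    where
    upwards : (if suc h <ᵇ k then go k w ω f n (suc h) else 0#)
            ≡ (if suc h <ᵇ k then go k w ω f′ n (suc h) else 0#)
    upwards = ≡.cong (λ z → if suc h <ᵇ k then z else 0#) (go-fuel f f′ n (suc h) n≤f n≤f′)
    downwards : ∀ h → downStep (go k w ω f n) h ≡ downStep (go k w ω f′ n) h
    downwards zero = ≡.refl
    downwards (suc h) = go-fuel f f′ n h n≤f n≤f′
    rest≤ : ∀ {f} → n ≤ f → n ∸ w′ ≤ f
    rest≤ = ≤-trans (m∸n≤m n w′)
    horizontal : (if w ≤ᵇ suc n then ω * go k w ω f (n ∸ w′) h else 0#)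
               ≡ (if w ≤ᵇ suc n then ω * go k w ω f′ (n ∸ w′) h else 0#)
    horizontal = ≡.cong (λ z → if w ≤ᵇ suc n then ω * z else 0#)
                        (go-fuel f f′ (n ∸ w′) h (rest≤ n≤f) (rest≤ n≤f′))

  δ : ℕ → Ser
  δ h = if h ≡ᵇ 0 then one else zeroS

  ω-guard : ∀ b x → ω * (if b then x else 0#) ≈ (if b then ω * x else 0#)
  ω-guard true x = refl
  ω-guard false x = zeroʳ ω

  -- First-step decomposition: a nonempty path starts with an up, a down or a
  -- horizontal step.
  walks-solve : Solves δ walks
  walks-solve h _ zero = begin
    walks h 0                            ≡⟨ ≡.sym (if-float (λ g → g 0) (h ≡ᵇ 0) {one} {zeroS}) ⟩
    δ h 0                                ≈⟨ sym (+-identityʳ _) ⟩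
    δ h 0 + 0#                           ≈⟨ +-congˡ (sym (trans (+-congˡ (zeroʳ ω)) (+-identityʳ 0#))) ⟩
    δ h 0 + (0# + ω * 0#)                ∎
    where open ≈-Reasoning
  walks-solve h _ (suc m) = begin
    walks h (suc m)
      ≡⟨ ≡.cong₂ (λ u d → (u + d) + flat) upwards (downwards h) ⟩
    vertical + flat                                  ≈⟨ +-congˡ horizontal ⟩
    vertical + ω * shift w (walks h) (suc m)         ≈⟨ sym (+-identityˡ _) ⟩
    0# + (vertical + ω * shift w (walks h) (suc m))  ≈⟨ +-congʳ (sym (δ-later h)) ⟩
    δ h (suc m) + (vertical + ω * shift w (walks h) (suc m)) ∎
    where
    open ≈-Reasoning
    vertical : Carrier
    vertical = up walks h m + down walks h m
    upwards : (if suc h <ᵇ k then go k w ω m m (suc h) else 0#) ≡ up walks h m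
    upwards = ≡.sym (if-float (λ g → g m) (suc h <ᵇ k) {walks (suc h)} {zeroS})
    downwards : ∀ h → downStep (go k w ω m m) h ≡ down walks h m
    downwards zero = ≡.refl
    downwards (suc h) = ≡.refl
    flat : Carrier
    flat = if w′ <ᵇ suc m then ω * go k w ω m (m ∸ w′) h else 0#
    horizontal : flat ≈ ω * shift w (walks h) (suc m)
    horizontal = sym (begin
      ω * shift w′ (walks h) m                                  ≡⟨ ≡.cong (ω *_) (shift-coeff w′ (walks h) m) ⟩
      ω * (if w′ <ᵇ suc m then walks h (m ∸ w′) else 0#)        ≈⟨ ω-guard (w′ <ᵇ suc m) _ ⟩
      (if w′ <ᵇ suc m then ω * walks h (m ∸ w′) else 0#)
        ≡⟨ ≡.cong (λ z → if w′ <ᵇ suc m then ω * z else 0#)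
                  (go-fuel (m ∸ w′) m (m ∸ w′) h ≤-refl (m∸n≤m m w′)) ⟩
      flat                                                      ∎)
    δ-later : ∀ h → δ h (suc m) ≈ 0#
    δ-later zero = refl
    δ-later (suc h) = refl

  -- The polynomial solution Y_h = t^h P_{k-1-h}, written with Q so that Y_k = 0.
  Y : ℕ → Ser
  Y h = shift h (Q (k ∸ h))

  source : ℕ → Ser
  source h = P w ω k ⊛ δ h

  -- The upper neighbour of Y_h is always Y_{h+1}: at the top of the strip both vanish.
  up-Y : ∀ h → up Y h ≋ Y (suc h)
  up-Y h with suc h <ᵇ k in eq
  ... | true = ≋-refl
  ... | false =
    ≋-sym (≋-trans (shift-cong (suc h) (≡⇒≋ (≡.cong Q (m≤n⇒m∸n≡0 k≤1+h)))) (shift-zero (suc h)))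
    where
    k≤1+h : k ≤ suc h
    k≤1+h = ≮⇒≥ (λ lt → ≡.subst T eq (<⇒<ᵇ lt))

  down-Y : ∀ h → h < k → (source h ⊕ shift 1 (down Y h)) ≋ shift h (Q (suc (k ∸ h)))
  down-Y zero _ = ≋-trans (⊕-cong (conv-oneʳ (P w ω k)) (shift-zero 1)) (⊕-identityʳ _)
  down-Y (suc h) h<k = begin
    (P w ω k ⊛ zeroS) ⊕ shift 1 (shift h (Q (k ∸ h)))  ≈⟨ ⊕-cong (conv-zeroʳ _) (shift-shift 1 h _) ⟩
    zeroS ⊕ shift (suc h) (Q (k ∸ h))                  ≈⟨ ⊕-identityˡ _ ⟩
    shift (suc h) (Q (k ∸ h))
      ≈⟨ shift-cong (suc h) (≡⇒≋ (≡.cong Q (∸-split (<⇒≤ h<k)))) ⟩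
    shift (suc h) (Q (suc (k ∸ suc h)))                ∎
    where open ≋-Reasoning

  -- Multiplying Y_h by A, the recurrence of Q splits it into the source
  -- and the two neighbours.
  A-Y : ∀ h → h < k → (A ⊛ Y h) ≋ (source h ⊕ shift 1 (up Y h ⊕ down Y h))
  A-Y h h<k = begin
    A ⊛ shift h (Q (k ∸ h))                                 ≈⟨ conv-shiftʳ h A _ ⟩
    shift h (A ⊛ Q (k ∸ h))                                 ≈⟨ shift-cong h recurrence ⟩
    shift h (Q (suc (suc r)) ⊕ shift 2 (Q r))               ≈⟨ shift-⊕ h _ _ ⟩
    shift h (Q (suc (suc r))) ⊕ shift h (shift 2 (Q r))     ≈⟨ ⊕-cong (≋-sym lower) upper ⟩
    (source h ⊕ shift 1 (down Y h)) ⊕ shift 1 (up Y h)      ≈⟨ ⊕-assoc _ _ _ ⟩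
    source h ⊕ (shift 1 (down Y h) ⊕ shift 1 (up Y h))
      ≈⟨ ⊕-cong ≋-refl (≋-trans (⊕-comm _ _) (≋-sym (shift-⊕ 1 _ _))) ⟩
    source h ⊕ shift 1 (up Y h ⊕ down Y h)                  ∎
    where
    open ≋-Reasoning
    r : ℕ
    r = k ∸ suc h
    recurrence : (A ⊛ Q (k ∸ h)) ≋ (Q (suc (suc r)) ⊕ shift 2 (Q r))
    recurrence = ≋-trans (≡⇒≋ (≡.cong (λ n → A ⊛ Q n) (∸-split h<k))) (Q-recurrence r)
    lower : (source h ⊕ shift 1 (down Y h)) ≋ shift h (Q (suc (suc r)))
    lower = ≋-trans (down-Y h h<k) (shift-cong h (≡⇒≋ (≡.cong (λ n → Q (suc n)) (∸-split h<k))))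
    upper : shift h (shift 2 (Q r)) ≋ shift 1 (up Y h)
    upper = ≋-trans (shift-shift h 2 _) (≋-trans (≡⇒≋ (≡.cong (λ d → shift d (Q r)) (+ℕ-comm h 2)))
              (≋-trans (≋-sym (shift-shift 1 (suc h) _)) (shift-cong 1 (≋-sym (up-Y h)))))

  polynomials-solve : Solves source Y
  polynomials-solve h h<k = begin
    Y h                                                                   ≈⟨ A-split (Y h) ⟩
    (A ⊛ Y h) ⊕ (ω · shift w (Y h))                                       ≈⟨ ⊕-cong (A-Y h h<k) ≋-refl ⟩
    (source h ⊕ shift 1 (up Y h ⊕ down Y h)) ⊕ (ω · shift w (Y h))        ≈⟨ ⊕-assoc _ _ _ ⟩
    source h ⊕ (shift 1 (up Y h ⊕ down Y h) ⊕ (ω · shift w (Y h)))        ∎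
    where open ≋-Reasoning

-- Both P_k · walks and the polynomial family Y solve the strip system with
-- source P_k [h = 0]; at height 0 the latter is Y_0 = P_{k-1}.

mainTheorem9 : {c ℓ : Level} (R : CommutativeRing c ℓ) (w k : ℕ) → 1 ≤ w → 1 ≤ k →
    (ω : CommutativeRing.Carrier R) → (n : ℕ) →
    CommutativeRing._≈_ R (Series._⊛_ R (Series.P R w ω k) (Series.W R k w ω) n) (Series.P R w ω (k ∸ 1) n)
mainTheorem9 R (suc w′) (suc k′) (s≤s _) (s≤s _) ω n =
  solution-unique walks-times-Pₖ polynomials-solve n 0 (s≤s z≤n)
  where
  open Series R using (P; _⊛_)
  open Strip R w′ (suc k′) ω
  walks-times-Pₖ : Solves source (λ h → P (suc w′) ω (suc k′) ⊛ walks h)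
  walks-times-Pₖ = Solves-⊛ (P (suc w′) ω (suc k′)) walks-solve
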